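{- Let $C$ be a single-sorted $<\kappa$-ary clone and let $(d,(e_s)_{s\in S})$ and $(d,(e'_s)_{s\in S})$ be $S$-ary diagonal pairs of $C$ (with the same $d$). Then $C_{(d,(e_s))}$ is isomorphic to $C_{(d,(e'_s))}$ via the isomorphism $\varphi=(\varphi_{(\lambda,v,s)})$ given by $\varphi_{(\lambda,v,s)}(f/\sim)=\big(e'_s\circ f\circ(e_{v(i)}\circ\pi_{(\lambda,i)})_{i\in\lambda}\big)/\sim'$, where $\sim,\sim'$ are the defining equivalences of $C_{(d,(e_s))}$ and $C_{(d,(e'_s))}$.
   Context: $S$ is a nonzero cardinal (set of smaller ordinals), $\kappa>S$ infinite. A single-sorted $<\kappa$-ary clone $C$ consists of sets $C_\lambda$ ($\lambda<\kappa$), projections $\pi_{(\lambda,i)}$ and associative compositions $f\circ(g_i)_i$ with projections as units. An $S$-ary diagonal pair is $(d,(e_s)_{s\in S})$, $d\in C_S$, $e_s\in C_1$, with (1) $e_s\circ d=e_s\circ\pi_{(S,s)}$; (2) $d\circ(e_s\circ\pi_{(S,s)})_{s\in S}=d$; (3) $d\circ(\pi_{(S,0)})_{s\in S}=\pi_{(S,0)}$. An $S$-sorted $<\kappa$-ary clone has sets $M_{(\lambda,v,s)}$ ($\lambda<\kappa$, $v:\lambda\to S$, $s\in S$), projections $\pi_{(\lambda,v,i)}\in M_{(\lambda,v,v(i))}$ and associative compositions $M_{(\lambda_1,v_1,s)}\times\prod_iM_{(\lambda_2,v_2,v_1(i))}\to M_{(\lambda_2,v_2,s)}$ with projections as units;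 isomorphisms are sortwise bijections preserving projections and composition. The heterogenization $C_{(d,(e_s))}$ is the $S$-sorted clone with $C_{(d,(e_s)),(\lambda,v,t)}=\{f\in C_\lambda:e_t\circ f=f\}/\sim_{\lambda,v}$, where $f\sim_{\lambda,v}g$ iff $f\circ(e_{v(i)}\circ\pi_{(\lambda,i)})_{i\in\lambda}=g\circ(e_{v(i)}\circ\pi_{(\lambda,i)})_{i\in\lambda}$, projections $\pi_{(\lambda,v,i)}=e_{v(i)}\circ\pi_{(\lambda,i)}/\sim$ and composition $(f/\sim,(g_i/\sim)_i)\mapsto(f\circ(g_i)_i)/\sim$. -}

module Defs where

open import Level using (0ℓ)
open import Data.Product using (Σ; Σ-syntax; _,_; proj₁; proj₂; _×_; ∃)
open import Relation.Binary.PropositionalEquality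
  using (_≡_; refl; sym; trans; cong; module ≡-Reasoning)
open import Relation.Binary.Bundles using (Setoid)

-- An arity universe: a type of arities (the cardinals λ < κ)
-- together with, for each arity λ, its type of positions El λ (the
-- ordinals < λ).

record Arities : Set₁ where
  field
    Ar         : Set
    El         : Ar → Set
    one        : Ar
    zero₁      : El one
    one-unique : (i : El one) → i ≡ zero₁

record Clone (A : Arities) : Set₁ where
  open Arities A
  infixl 9 _∘_
  field
    C     : Ar → Set
    π     : (λ′ : Ar) → El λ′ → C λ′
    _∘_   : {λ₁ λ₂ : Ar} → C λ₁ → (El λ₁ → C λ₂) → C λ₂
    assoc : {λ₁ λ₂ λ₃ : Ar} (f : C λ₁) (g : El λ₁ → C λ₂) (h : El λ₂ → C λ₃) →
            f ∘ (λ i → g i ∘ h) ≡ (f ∘ g) ∘ h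
    unitˡ : {λ₁ λ₂ : Ar} (i : El λ₁) (g : El λ₁ → C λ₂) → π λ₁ i ∘ g ≡ g i
    unitʳ : {λ₁ : Ar} (f : C λ₁) → f ∘ π λ₁ ≡ f
    -- composition depends only on the family (g_i)_i (extensionality,
    -- automatic in the set-theoretic definition)
    ∘-cong : {λ₁ λ₂ : Ar} (f : C λ₁) {g h : El λ₁ → C λ₂} →
             ((i : El λ₁) → g i ≡ h i) → f ∘ g ≡ f ∘ h

  infixl 9 _∘₁_
  _∘₁_ : {λ₁ : Ar} → C one → C λ₁ → C λ₁
  e ∘₁ f = e ∘ (λ _ → f)

module _ {A : Arities} (Cl : Clone A) where
  open Arities A
  open Clone Cl

  record IsDiagonalPair (S : Ar) (s₀ : El S) (d : C S) (e : El S → C one) : Set where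
    field
      diag₁ : (s : El S) → e s ∘₁ d ≡ e s ∘₁ π S s
      diag₂ : d ∘ (λ s → e s ∘₁ π S s) ≡ d
      diag₃ : d ∘ (λ _ → π S s₀) ≡ π S s₀

-- S-sorted <κ-ary clone data: carriers (as setoids, since the carriers
-- of a heterogenization are quotients), projections and composition.
-- M λ v s  is  M_(λ,v,s).

record SortedCloneData (A : Arities) (S : Arities.Ar A) : Set₁ where
  open Arities A
  field
    M    : (λ′ : Ar) → (El λ′ → El S) → El S → Setoid 0ℓ 0ℓ
    proj : (λ′ : Ar) (v : El λ′ → El S) (i : El λ′) → Setoid.Carrier (M λ′ v (v i))
    comp : {λ₁ λ₂ : Ar} {v₁ : El λ₁ → El S} {v₂ : El λ₂ → El S} {s : El S} →
           Setoid.Carrier (M λ₁ v₁ s) →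
           ((i : El λ₁) → Setoid.Carrier (M λ₂ v₂ (v₁ i))) →
           Setoid.Carrier (M λ₂ v₂ s)

module _ {A : Arities} {S : Arities.Ar A} where
  open Arities A
  open SortedCloneData

  SortedMap : SortedCloneData A S → SortedCloneData A S → Set
  SortedMap P Q = (λ′ : Ar) (v : El λ′ → El S) (s : El S) →
                  Setoid.Carrier (M P λ′ v s) → Setoid.Carrier (M Q λ′ v s)

  record IsIsomorphism (P Q : SortedCloneData A S) (φ : SortedMap P Q) : Set where
    field
      well-defined : {λ′ : Ar} {v : El λ′ → El S} {s : El S}
                     {x y : Setoid.Carrier (M P λ′ v s)} →
                     Setoid._≈_ (M P λ′ v s) x y → Setoid._≈_ (M Q λ′ v s) (φ λ′ v s x) (φ λ′ v s y)
      injective    : {λ′ : Ar} {v : El λ′ → El S} {s : El S}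
                     {x y : Setoid.Carrier (M P λ′ v s)} →
                     Setoid._≈_ (M Q λ′ v s) (φ λ′ v s x) (φ λ′ v s y) → Setoid._≈_ (M P λ′ v s) x y
      surjective   : {λ′ : Ar} {v : El λ′ → El S} {s : El S}
                     (y : Setoid.Carrier (M Q λ′ v s)) →
                     Σ (Setoid.Carrier (M P λ′ v s)) (λ x → Setoid._≈_ (M Q λ′ v s) (φ λ′ v s x) y)
      pres-proj    : (λ′ : Ar) (v : El λ′ → El S) (i : El λ′) →
                     Setoid._≈_ (M Q λ′ v (v i)) (φ λ′ v (v i) (proj P λ′ v i)) (proj Q λ′ v i)
      pres-comp    : {λ₁ λ₂ : Ar} {v₁ : El λ₁ → El S} {v₂ : El λ₂ → El S} {s : El S}
                     (f : Setoid.Carrier (M P λ₁ v₁ s))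
                     (g : (i : El λ₁) → Setoid.Carrier (M P λ₂ v₂ (v₁ i))) →
                     Setoid._≈_ (M Q λ₂ v₂ s) (φ λ₂ v₂ s (comp P f g))
                                                   (comp Q (φ λ₁ v₁ s f) (λ i → φ λ₂ v₂ (v₁ i) (g i)))

module Heterogenization {A : Arities} (Cl : Clone A) (S : Arities.Ar A) (s₀ : Arities.El A S)
                        (d : Clone.C Cl S) (e : Arities.El A S → Clone.C Cl (Arities.one A))
                        (dp : IsDiagonalPair Cl S s₀ d e) where
  open Arities A
  open Clone Cl
  open IsDiagonalPair dp
  open ≡-Reasoning

  ev : (λ′ : Ar) → (El λ′ → El S) → El λ′ → C λ′
  ev λ′ v i = e (v i) ∘₁ π λ′ i

  Sim : (λ′ : Ar) → (El λ′ → El S) → C λ′ → C λ′ → Set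
  Sim λ′ v f g = f ∘ ev λ′ v ≡ g ∘ ev λ′ v

  private
    G : El S → C S
    G s = e s ∘₁ π S s

    step : (s : El S) → (e s ∘₁ e s) ∘ (λ _ → π S s) ≡ e s ∘₁ π S s
    step s = begin
      (e s ∘₁ e s) ∘ (λ _ → π S s)      ≡⟨ sym (assoc (e s) (λ _ → e s) (λ _ → π S s)) ⟩
      e s ∘₁ (e s ∘₁ π S s)             ≡⟨ ∘-cong (e s) (λ _ → sym (unitˡ s G)) ⟩
      e s ∘ (λ _ → π S s ∘ G)           ≡⟨ assoc (e s) (λ _ → π S s) G ⟩
      (e s ∘₁ π S s) ∘ G                ≡⟨ cong (_∘ G) (sym (diag₁ s)) ⟩
      (e s ∘₁ d) ∘ G                    ≡⟨ sym (assoc (e s) (λ _ → d) G) ⟩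
      e s ∘₁ (d ∘ G)                    ≡⟨ cong (e s ∘₁_) diag₂ ⟩
      e s ∘₁ d                          ≡⟨ diag₁ s ⟩
      e s ∘₁ π S s                      ∎

    H : El S → C one
    H _ = π one zero₁

    collapse : (X : C one) (s : El S) → (X ∘ (λ _ → π S s)) ∘ H ≡ X
    collapse X s = begin
      (X ∘ (λ _ → π S s)) ∘ H           ≡⟨ sym (assoc X (λ _ → π S s) H) ⟩
      X ∘ (λ _ → π S s ∘ H)             ≡⟨ ∘-cong X (λ _ → unitˡ s H) ⟩
      X ∘ (λ _ → π one zero₁)           ≡⟨ ∘-cong X (λ i → cong (π one) (sym (one-unique i))) ⟩
      X ∘ π one                         ≡⟨ unitʳ X ⟩
      X                                 ∎

  idem : (s : El S) → e s ∘₁ e s ≡ e s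
  idem s = begin
    e s ∘₁ e s                          ≡⟨ sym (collapse (e s ∘₁ e s) s) ⟩
    ((e s ∘₁ e s) ∘ (λ _ → π S s)) ∘ H  ≡⟨ cong (_∘ H) (step s) ⟩
    (e s ∘ (λ _ → π S s)) ∘ H           ≡⟨ collapse (e s) s ⟩
    e s                                 ∎

  idem₁ : {λ′ : Ar} (s : El S) (f : C λ′) → e s ∘₁ (e s ∘₁ f) ≡ e s ∘₁ f
  idem₁ s f = trans (assoc (e s) (λ _ → e s) (λ _ → f)) (cong (λ x → x ∘ (λ _ → f)) (idem s))

  Carrier : (λ′ : Ar) → El S → Set
  Carrier λ′ t = Σ (C λ′) (λ f → e t ∘₁ f ≡ f)

  setoid : (λ′ : Ar) → (El λ′ → El S) → El S → Setoid 0ℓ 0ℓ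
  setoid λ′ v t = record
    { Carrier       = Carrier λ′ t
    ; _≈_           = λ x y → Sim λ′ v (proj₁ x) (proj₁ y)
    ; isEquivalence = record { refl = refl ; sym = sym ; trans = trans }
    }

  het : SortedCloneData A S
  het = record
    { M    = setoid
    ; proj = λ λ′ v i → ev λ′ v i , idem₁ (v i) (π λ′ i)
    ; comp = λ {_} {_} {_} {_} {s} f g →
               proj₁ f ∘ (λ i → proj₁ (g i)) ,
               trans (assoc (e s) (λ _ → proj₁ f) (λ i → proj₁ (g i)))
                     (cong (_∘ (λ i → proj₁ (g i))) (proj₂ f))
    }

module Submission where

-- Both families e and e′ satisfy the diagonal axioms with the same d, and this alone forces
-- e′ₛ ∘ eₛ = e′ₛ and eₛ ∘ e′ₛ = eₛ.  Hence the transfer f ↦ e′ₜ ∘ f ∘ (e_{v(i)} ∘ πᵢ)ᵢ and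
-- the reverse transfer along e are mutually inverse up to the equivalences ∼ and ∼′, and
-- the transfer commutes with projections and composition because every substitution it
-- inserts is absorbed by the next one.

open import Defs
open import Data.Product using (Σ; _×_; proj₁; proj₂; _,_)
open import Relation.Binary.PropositionalEquality using (_≡_; refl; sym; trans; cong; module ≡-Reasoning)

module CloneProperties {A : Arities} (Cl : Clone A) where
  open Arities A
  open Clone Cl
  open ≡-Reasoning

  ∘₁-assoc : {λ₁ λ₂ : Ar} (u : C one) (f : C λ₁) (g : El λ₁ → C λ₂) → u ∘₁ (f ∘ g) ≡ (u ∘₁ f) ∘ g
  ∘₁-assoc u f = assoc u (λ _ → f)

  ∘₁-π-∘ : {λ₁ λ₂ : Ar} (u : C one) (i : El λ₁) (h : El λ₁ → C λ₂) → (u ∘₁ π λ₁ i) ∘ h ≡ u ∘₁ h i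
  ∘₁-π-∘ u i h = trans (sym (assoc u (λ _ → π _ i) h)) (∘-cong u (λ _ → unitˡ i h))

  ∘₁-π-one : (u : C one) → u ∘₁ π one zero₁ ≡ u
  ∘₁-π-one u = trans (∘-cong u (λ i → cong (π one) (sym (one-unique i)))) (unitʳ u)

  -- Precomposing with a unary projection is undone by substituting π₁ for every variable.
  ∘₁-π-cancel : (S : Ar) (s : El S) {u w : C one} → u ∘₁ π S s ≡ w ∘₁ π S s → u ≡ w
  ∘₁-π-cancel S s {u} {w} p = begin
    u                                        ≡⟨ sym (∘₁-π-one u) ⟩
    u ∘₁ π one zero₁                         ≡⟨ sym (∘₁-π-∘ u s (λ _ → π one zero₁)) ⟩
    (u ∘₁ π S s) ∘ (λ _ → π one zero₁)       ≡⟨ cong (_∘ (λ _ → π one zero₁)) p ⟩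
    (w ∘₁ π S s) ∘ (λ _ → π one zero₁)       ≡⟨ ∘₁-π-∘ w s (λ _ → π one zero₁) ⟩
    w ∘₁ π one zero₁                         ≡⟨ ∘₁-π-one w ⟩
    w                                        ∎

  module _ {S : Ar} where

    Absorbs : (El S → C one) → (El S → C one) → Set
    Absorbs e e′ = (s : El S) → e s ∘₁ e′ s ≡ e s

    absorbs-idempotent : {e e′ : El S → C one} → Absorbs e e′ → Absorbs e′ e → Absorbs e e
    absorbs-idempotent {e} {e′} ee′ e′e s = begin
      e s ∘₁ e s                 ≡⟨ cong (_∘₁ e s) (sym (ee′ s)) ⟩
      (e s ∘₁ e′ s) ∘₁ e s       ≡⟨ sym (∘₁-assoc (e s) (e′ s) (λ _ → e s)) ⟩
      e s ∘₁ (e′ s ∘₁ e s)       ≡⟨ cong (e s ∘₁_) (e′e s) ⟩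
      e s ∘₁ e′ s                ≡⟨ ee′ s ⟩
      e s                        ∎

    diagonal-absorbs : {d : C S} {e e′ : El S → C one} →
                       ((s : El S) → e′ s ∘₁ d ≡ e′ s ∘₁ π S s) →
                       d ∘ (λ s → e s ∘₁ π S s) ≡ d → Absorbs e′ e
    diagonal-absorbs {d} {e} {e′} diag₁′ diag₂ s = ∘₁-π-cancel S s (begin
      (e′ s ∘₁ e s) ∘₁ π S s     ≡⟨ sym (∘₁-assoc (e′ s) (e s) (λ _ → π S s)) ⟩
      e′ s ∘₁ (e s ∘₁ π S s)     ≡⟨ cong (e′ s ∘₁_) (sym (unitˡ s G)) ⟩
      e′ s ∘₁ (π S s ∘ G)        ≡⟨ ∘₁-assoc (e′ s) (π S s) G ⟩
      (e′ s ∘₁ π S s) ∘ G        ≡⟨ cong (_∘ G) (sym (diag₁′ s)) ⟩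
      (e′ s ∘₁ d) ∘ G            ≡⟨ sym (∘₁-assoc (e′ s) d G) ⟩
      e′ s ∘₁ (d ∘ G)            ≡⟨ cong (e′ s ∘₁_) diag₂ ⟩
      e′ s ∘₁ d                  ≡⟨ diag₁′ s ⟩
      e′ s ∘₁ π S s              ∎)
      where
        G : El S → C S
        G s = e s ∘₁ π S s

    ev : (El S → C one) → (λ′ : Ar) → (El λ′ → El S) → El λ′ → C λ′
    ev e λ′ v i = e (v i) ∘₁ π λ′ i

    transfer : (El S → C one) → (El S → C one) → (λ′ : Ar) → (El λ′ → El S) → El S → C λ′ → C λ′
    transfer e e′ λ′ v t f = e′ t ∘₁ (f ∘ ev e λ′ v)

    module _ {e e′ : El S → C one} (ee′ : Absorbs e e′) {λ′ : Ar} {v : El λ′ → El S} where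

      ev-absorbs : (i : El λ′) → ev e λ′ v i ∘ ev e′ λ′ v ≡ ev e λ′ v i
      ev-absorbs i = begin
        (e (v i) ∘₁ π λ′ i) ∘ ev e′ λ′ v     ≡⟨ ∘₁-π-∘ (e (v i)) i (ev e′ λ′ v) ⟩
        e (v i) ∘₁ (e′ (v i) ∘₁ π λ′ i)      ≡⟨ ∘₁-assoc (e (v i)) (e′ (v i)) (λ _ → π λ′ i) ⟩
        (e (v i) ∘₁ e′ (v i)) ∘₁ π λ′ i      ≡⟨ cong (_∘₁ π λ′ i) (ee′ (v i)) ⟩
        e (v i) ∘₁ π λ′ i                    ∎

      ∘ev-absorbs : (f : C λ′) → (f ∘ ev e λ′ v) ∘ ev e′ λ′ v ≡ f ∘ ev e λ′ v
      ∘ev-absorbs f = trans (sym (assoc f (ev e λ′ v) (ev e′ λ′ v))) (∘-cong f ev-absorbs)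

      transfer-stable : (t : El S) (f : C λ′) → transfer e e′ λ′ v t f ∘ ev e′ λ′ v ≡ transfer e e′ λ′ v t f
      transfer-stable t f = trans (sym (∘₁-assoc (e′ t) (f ∘ ev e λ′ v) (ev e′ λ′ v)))
                                  (cong (e′ t ∘₁_) (∘ev-absorbs f))

      absorb-transfer : {t : El S} {f : C λ′} → e t ∘₁ f ≡ f → e t ∘₁ transfer e e′ λ′ v t f ≡ f ∘ ev e λ′ v
      absorb-transfer {t} {f} closed = begin
        e t ∘₁ (e′ t ∘₁ (f ∘ ev e λ′ v))     ≡⟨ ∘₁-assoc (e t) (e′ t) (λ _ → f ∘ ev e λ′ v) ⟩
        (e t ∘₁ e′ t) ∘₁ (f ∘ ev e λ′ v)     ≡⟨ cong (_∘₁ (f ∘ ev e λ′ v)) (ee′ t) ⟩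
        e t ∘₁ (f ∘ ev e λ′ v)               ≡⟨ ∘₁-assoc (e t) f (ev e λ′ v) ⟩
        (e t ∘₁ f) ∘ ev e λ′ v               ≡⟨ cong (_∘ ev e λ′ v) closed ⟩
        f ∘ ev e λ′ v                        ∎

      transfer-inverse : {t : El S} {f : C λ′} → e t ∘₁ f ≡ f →
                         transfer e′ e λ′ v t (transfer e e′ λ′ v t f) ≡ f ∘ ev e λ′ v
      transfer-inverse {t} {f} closed =
        trans (cong (e t ∘₁_) (transfer-stable t f)) (absorb-transfer closed)

    transfer-closed : {e e′ : El S → C one} → Absorbs e′ e′ → (λ′ : Ar) (v : El λ′ → El S)
                      (t : El S) (f : C λ′) → e′ t ∘₁ transfer e e′ λ′ v t f ≡ transfer e e′ λ′ v t f
    transfer-closed {e} {e′} idem λ′ v t f =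
      trans (∘₁-assoc (e′ t) (e′ t) (λ _ → f ∘ ev e λ′ v)) (cong (_∘₁ (f ∘ ev e λ′ v)) (idem t))

    transfer-π : {e e′ : El S → C one} → Absorbs e e → Absorbs e′ e → (λ′ : Ar) (v : El λ′ → El S) (i : El λ′) →
                 transfer e e′ λ′ v (v i) (ev e λ′ v i) ≡ ev e′ λ′ v i
    transfer-π {e} {e′} idem e′e λ′ v i = begin
      e′ (v i) ∘₁ (ev e λ′ v i ∘ ev e λ′ v)   ≡⟨ cong (e′ (v i) ∘₁_) (ev-absorbs idem i) ⟩
      e′ (v i) ∘₁ (e (v i) ∘₁ π λ′ i)         ≡⟨ ∘₁-assoc (e′ (v i)) (e (v i)) (λ _ → π λ′ i) ⟩
      (e′ (v i) ∘₁ e (v i)) ∘₁ π λ′ i         ≡⟨ cong (_∘₁ π λ′ i) (e′e (v i)) ⟩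
      e′ (v i) ∘₁ π λ′ i                      ∎

    transfer-∘ : {e e′ : El S → C one} → Absorbs e e′ →
                 {λ₁ λ₂ : Ar} {v₁ : El λ₁ → El S} {v₂ : El λ₂ → El S} (s : El S)
                 (f : C λ₁) (g : El λ₁ → C λ₂) → ((i : El λ₁) → e (v₁ i) ∘₁ g i ≡ g i) →
                 transfer e e′ λ₂ v₂ s (f ∘ g)
                   ≡ transfer e e′ λ₁ v₁ s f ∘ (λ i → transfer e e′ λ₂ v₂ (v₁ i) (g i))
    transfer-∘ {e} {e′} ee′ {λ₁} {λ₂} {v₁} {v₂} s f g closed = sym (begin
      (e′ s ∘₁ (f ∘ ev e λ₁ v₁)) ∘ h         ≡⟨ sym (∘₁-assoc (e′ s) (f ∘ ev e λ₁ v₁) h) ⟩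
      e′ s ∘₁ ((f ∘ ev e λ₁ v₁) ∘ h)         ≡⟨ cong (e′ s ∘₁_) (sym (assoc f (ev e λ₁ v₁) h)) ⟩
      e′ s ∘₁ (f ∘ (λ i → ev e λ₁ v₁ i ∘ h)) ≡⟨ cong (e′ s ∘₁_) (∘-cong f ev∘h) ⟩
      e′ s ∘₁ (f ∘ (λ i → g i ∘ ev e λ₂ v₂)) ≡⟨ cong (e′ s ∘₁_) (assoc f g (ev e λ₂ v₂)) ⟩
      e′ s ∘₁ ((f ∘ g) ∘ ev e λ₂ v₂)         ∎)
      where
        h : El λ₁ → C λ₂
        h i = transfer e e′ λ₂ v₂ (v₁ i) (g i)

        ev∘h : (i : El λ₁) → ev e λ₁ v₁ i ∘ h ≡ g i ∘ ev e λ₂ v₂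
        ev∘h i = trans (∘₁-π-∘ (e (v₁ i)) i h) (absorb-transfer ee′ (closed i))

module HeterogenizationIsomorphism {A : Arities} (Cl : Clone A) (S : Arities.Ar A) (s₀ : Arities.El A S)
                                   (d : Clone.C Cl S) (e e′ : Arities.El A S → Clone.C Cl (Arities.one A))
                                   (dp : IsDiagonalPair Cl S s₀ d e) (dp′ : IsDiagonalPair Cl S s₀ d e′) where
  open Arities A
  open Clone Cl
  open CloneProperties Cl
  module H = Heterogenization Cl S s₀ d e dp
  module H′ = Heterogenization Cl S s₀ d e′ dp′

  e′e : Absorbs e′ e
  e′e = diagonal-absorbs (IsDiagonalPair.diag₁ dp′) (IsDiagonalPair.diag₂ dp)

  ee′ : Absorbs e e′
  ee′ = diagonal-absorbs (IsDiagonalPair.diag₁ dp) (IsDiagonalPair.diag₂ dp′)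

  ee : Absorbs e e
  ee = absorbs-idempotent ee′ e′e

  e′e′ : Absorbs e′ e′
  e′e′ = absorbs-idempotent e′e ee′

  φ : SortedMap H.het H′.het
  φ λ′ v t x = transfer e e′ λ′ v t (proj₁ x) , transfer-closed {e = e} e′e′ λ′ v t (proj₁ x)

  φ-isomorphism : IsIsomorphism H.het H′.het φ
  φ-isomorphism = record
    { well-defined = λ {_} {v} {t} p → cong (λ z → (e′ t ∘₁ z) ∘ H′.ev _ v) p
    ; injective    = λ {_} {_} {t} {x} {y} p →
        trans (sym (transfer-inverse ee′ (proj₂ x)))
              (trans (cong (e t ∘₁_) p) (transfer-inverse ee′ (proj₂ y)))
    ; surjective   = λ {λ′} {v} {t} y →
        (transfer e′ e λ′ v t (proj₁ y) , transfer-closed {e = e′} ee λ′ v t (proj₁ y)) ,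
        trans (cong (_∘ H′.ev λ′ v) (transfer-inverse e′e (proj₂ y))) (∘ev-absorbs e′e′ (proj₁ y))
    ; pres-proj    = λ λ′ v i → cong (_∘ H′.ev λ′ v) (transfer-π ee e′e λ′ v i)
    ; pres-comp    = λ {_} {λ₂} {_} {v₂} {s} f g →
        cong (_∘ H′.ev λ₂ v₂) (transfer-∘ ee′ s (proj₁ f) (λ i → proj₁ (g i)) (λ i → proj₂ (g i)))
    }

proposition5p5 : (A : Arities) (Cl : Clone A) (S : Arities.Ar A) (s₀ : Arities.El A S)
                 (d : Clone.C Cl S) (e e′ : Arities.El A S → Clone.C Cl (Arities.one A))
                 (dp : IsDiagonalPair Cl S s₀ d e) (dp′ : IsDiagonalPair Cl S s₀ d e′) →
                 Σ (SortedMap (Heterogenization.het Cl S s₀ d e dp) (Heterogenization.het Cl S s₀ d e′ dp′))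
                   (λ φ → ((λ′ : Arities.Ar A) (v : Arities.El A λ′ → Arities.El A S) (t : Arities.El A S)
                           (x : Heterogenization.Carrier Cl S s₀ d e dp λ′ t) →
                           proj₁ (φ λ′ v t x)
                             ≡ Clone._∘₁_ Cl {λ′} (e′ t) (Clone._∘_ Cl (proj₁ x) (Heterogenization.ev Cl S s₀ d e dp λ′ v)))
                          × IsIsomorphism (Heterogenization.het Cl S s₀ d e dp) (Heterogenization.het Cl S s₀ d e′ dp′) φ)
proposition5p5 A Cl S s₀ d e e′ dp dp′ = φ , (λ _ _ _ _ → refl) , φ-isomorphism
  where open HeterogenizationIsomorphism Cl S s₀ d e e′ dp dp′
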